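{- For any two positive integers $k$ and $n$ such that $k$ divides $n$, there exists a connected trivially perfect graph $G$ on $n+1$ vertices such that $\mathit{td}(G)=n/k+1$ and $\delta(\mathcal{A}(G))\ge \mathit{td}(G)\cdot n/2$.
   Context: For a connected graph $G=(V,E)$, a search tree on $G$ is a rooted tree with vertex set $V$ defined recursively: its root is some vertex $r\in V$, and $r$ is joined to the roots of search trees on each connected component of $G-r$. The tubes of a search tree are the vertex sets of its subtrees. Two search trees on $G$ are related by a rotation if their sets of tubes have symmetric difference of size exactly two. The graph associahedron $\mathcal{A}(G)$ is a polytope whose skeleton is isomorphic to the graph on search trees of $G$ with adjacency given by rotations; $\delta(\mathcal{A}(G))$ is the diameter of this graph. The tree-depth $\mathit{td}(G)$ is the minimum height of a search tree on $G$, where a single vertex has height one. A graph is trivially perfect if it can be built recursively from single vertices by (i) adding a new vertex adjacent to all existing vertices and (ii) taking disjoint unions of two trivially perfect graphs. -}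

module Defs where

open import Data.Nat using (ℕ; zero; suc; _+_; _⊔_; _≤_)
open import Data.Bool using (Bool; true; false)
open import Data.Fin using (Fin; zero; suc; splitAt)
open import Data.Fin.Subset using (Subset; _∈_; _⊆_; _-_)
open import Data.List using (List; []; _∷_; map)
open import Data.List.Relation.Unary.All using (All)
open import Data.List.Relation.Unary.Any using (Any)
open import Data.List.Relation.Unary.Unique.Propositional using (Unique)
open import Data.Product using (Σ; ∃; _×_; proj₁; proj₂)
open import Data.Sum using (_⊎_; inj₁; inj₂)
open import Relation.Binary.PropositionalEquality using (_≡_; _≢_)
open import Relation.Nullary using (¬_)
open import Function.Bundles using (_↔_; Inverse)

Graph : ℕ → Set
Graph m = Fin m → Fin m → Bool

IsSimple : ∀ {m} → Graph m → Set
IsSimple {m} G = (∀ i j → G i j ≡ G j i) × (∀ i → G i i ≡ false)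

_≅_ : ∀ {m} → Graph m → Graph m → Set
_≅_ {m} G H = Σ (Fin m ↔ Fin m) λ f →
  ∀ i j → G i j ≡ H (Inverse.to f i) (Inverse.to f j)

data PathIn {m} (G : Graph m) (S : Subset m) : Fin m → Fin m → Set where
  here : ∀ {u} → u ∈ S → PathIn G S u u
  step : ∀ {u v w} → u ∈ S → G u v ≡ true → PathIn G S v w → PathIn G S u w

Connected : ∀ {m} → Graph m → Subset m → Set
Connected {m} G S =
  (Σ (Fin m) λ v → v ∈ S) × (∀ u v → u ∈ S → v ∈ S → PathIn G S u v)

IsComponent : ∀ {m} → Graph m → Subset m → Subset m → Set
IsComponent {m} G S C = C ⊆ S × Connected G C ×
  (∀ u v → u ∈ C → v ∈ S → G u v ≡ true → v ∈ C)

AreComponents : ∀ {m} → Graph m → Subset m → List (Subset m) → Set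
AreComponents {m} G S Cs = All (IsComponent G S) Cs × Unique Cs ×
  (∀ v → v ∈ S → Any (v ∈_) Cs)

data SearchTree {m} (G : Graph m) : Subset m → Set where
  node : (S : Subset m) (r : Fin m) → r ∈ S →
         (cs : List (Σ (Subset m) (SearchTree G))) →
         AreComponents G (S - r) (map proj₁ cs) →
         SearchTree G S

-- height (a single vertex has height one)
mutual
  height : ∀ {m} {G : Graph m} {S} → SearchTree G S → ℕ
  height (node S r _ cs _) = suc (heights cs)

  heights : ∀ {m} {G : Graph m} → List (Σ (Subset m) (SearchTree G)) → ℕ
  heights []             = 0
  heights ((_ Data.Product., t) ∷ cs) = height t ⊔ heights cs

data IsTube {m} {G : Graph m} : ∀ {S} → SearchTree G S → Subset m → Set where
  root : ∀ {S} (t : SearchTree G S) → IsTube t S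
  sub  : ∀ {S r r∈ cs comp X} →
         Any (λ p → IsTube (proj₂ p) X) cs →
         IsTube (node S r r∈ cs comp) X

SearchTreeOn : ∀ {m} → Graph m → Set
SearchTreeOn {m} G = SearchTree G (Data.Fin.Subset.⊤)

InSymDiff : ∀ {m} {G : Graph m} → SearchTreeOn G → SearchTreeOn G → Subset m → Set
InSymDiff T U X = (IsTube T X × ¬ IsTube U X) ⊎ (IsTube U X × ¬ IsTube T X)

Rotation : ∀ {m} {G : Graph m} → SearchTreeOn G → SearchTreeOn G → Set
Rotation {m} T U = Σ (Subset m) λ X → Σ (Subset m) λ Y →
  X ≢ Y × InSymDiff T U X × InSymDiff T U Y ×
  (∀ Z → InSymDiff T U Z → Z ≡ X ⊎ Z ≡ Y)

-- two representations of the same search tree (same tube sets)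
SameTree : ∀ {m} {G : Graph m} → SearchTreeOn G → SearchTreeOn G → Set
SameTree {m} T U = ∀ (X : Subset m) → (IsTube T X → IsTube U X) × (IsTube U X → IsTube T X)

data RotPath {m} {G : Graph m} : SearchTreeOn G → SearchTreeOn G → ℕ → Set where
  done : ∀ {T U} → SameTree T U → RotPath T U 0
  step : ∀ {T U V k} → Rotation T U → RotPath U V k → RotPath T V (suc k)

-- δ(A(G)) ≥ a / b  : some pair of search trees is at rotation distance
-- at least a / b, i.e. every rotation sequence between them has length k
-- with a ≤ b * k.
DiameterAtLeast : ∀ {m} → Graph m → ℕ → ℕ → Set
DiameterAtLeast G a b = Σ (SearchTreeOn G) λ T → Σ (SearchTreeOn G) λ U →
  ∀ k → RotPath T U k → a ≤ b Data.Nat.* k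

TreeDepth : ∀ {m} → Graph m → ℕ → Set
TreeDepth G h = (Σ (SearchTreeOn G) λ T → height T ≡ h) ×
  (∀ (T : SearchTreeOn G) → h ≤ height T)

-- Trivially perfect graphs: built from single vertices by adding a
-- universal vertex and taking disjoint unions (up to isomorphism).

data TPBuild : ℕ → Set where
  single : TPBuild 1
  cone   : ∀ {m} → TPBuild m → TPBuild (suc m)
  union  : ∀ {a b} → TPBuild a → TPBuild b → TPBuild (a + b)

coneGraph : ∀ {m} → Graph m → Graph (suc m)
coneGraph G zero    zero    = false
coneGraph G zero    (suc j) = true
coneGraph G (suc i) zero    = true
coneGraph G (suc i) (suc j) = G i j

unionGraph : ∀ {a b} → Graph a → Graph b → Graph (a + b)
unionGraph {a} G H i j with splitAt a i | splitAt a j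
... | inj₁ i′ | inj₁ j′ = G i′ j′
... | inj₂ i′ | inj₂ j′ = H i′ j′
... | _       | _       = false

⟦_⟧ : ∀ {m} → TPBuild m → Graph m
⟦ single ⟧    = λ _ _ → false
⟦ cone t ⟧    = coneGraph ⟦ t ⟧
⟦ union s t ⟧ = unionGraph ⟦ s ⟧ ⟦ t ⟧

TriviallyPerfect : ∀ {m} → Graph m → Set
TriviallyPerfect {m} G = Σ (TPBuild m) λ t → G ≅ ⟦ t ⟧

{-# OPTIONS --safe #-}
module Submission where

-- The witness is the cone over k disjoint copies of K_q, where q = n / k; it is trivially
-- perfect.  The cone vertex together with one copy of K_q is a clique forcing every search tree
-- to have height at least q + 1, which the cone vertex above a path through each copy attains.
-- A search tree orients each edge from the endpoint whose tube contains the other.  A rotation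
-- exchanges a single tube for another, and both determine the reversed edge, so a rotation
-- reverses at most one edge.  The tree T₀ orients every edge towards its larger endpoint, the
-- path U through all vertices in decreasing order towards its smaller one.  Hence a rotation
-- sequence from T₀ to U has length at least the number of edges, n + k·q(q - 1)/2 = (q + 1)·n/2.

open import Defs
open import Data.Bool as Bool using (true; false; _∧_; not; if_then_else_)
open import Data.Empty using (⊥; ⊥-elim)
open import Data.Fin as Fin using (Fin; zero; suc; toℕ)
open import Data.Fin.Properties as Finₚ using (_≟_)
open import Data.Fin.Subset using (Subset; _∈_; _∉_; _⊆_; _-_; ⁅_⁆; ⊤)
open import Data.Fin.Subset.Properties using (_∈?_; ∈⊤; ⊆-antisym; p─q⊆p; x∈p∧x≢y⇒x∈p-y)
open import Data.List as List using (List; []; _∷_; map; length)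
open import Data.List.Membership.Propositional using () renaming (_∈_ to _∈ₗ_)
import Data.List.Membership.Propositional.Properties as Listₚ
import Data.List.Properties as Listₚ′
open import Data.List.Relation.Unary.All as All using (All; []; _∷_)
import Data.List.Relation.Unary.All.Properties as Allₚ
open import Data.List.Relation.Unary.AllPairs as AllPairs using (AllPairs; []; _∷_)
import Data.List.Relation.Unary.AllPairs.Properties as AllPairsₚ
open import Data.List.Relation.Unary.Any as Any using (Any; here; there)
import Data.List.Relation.Unary.Any.Properties as Anyₚ
open import Data.List.Relation.Unary.Unique.Propositional using (Unique)
open import Data.Nat as ℕ using (ℕ; zero; suc; _+_; _*_; _/_; _≤_; _<_; _⊔_; z≤n; s≤s; NonZero)
open import Data.Nat.Divisibility using (_∣_; divides)
open import Data.Nat.DivMod using (m*n/n≡m)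
import Data.Nat.Properties as ℕₚ
open import Algebra.Properties.CommutativeMonoid.Sum ℕₚ.+-0-commutativeMonoid
  using (sum; sum-syntax; sum-cong-≗; sum-replicate-zero; ∑-distrib-+; ∑-comm)
open import Data.Product using (Σ; ∃; _×_; _,_; proj₁; proj₂; map₂)
open import Data.Sum as ⊎ using (_⊎_; inj₁; inj₂)
open import Data.Vec as Vec using (_∷_; here; there)
import Data.Vec.Properties as Vecₚ
open import Function using (_∘′_; case_of_)
open import Function.Bundles using (mk⇔)
open import Function.Construct.Identity using (↔-id)
open import Relation.Binary.Definitions using (tri<; tri≈; tri>)
open import Relation.Binary.PropositionalEquality
open import Relation.Nullary using (¬_; Dec; yes; no; does; ¬?; _×-dec_; map′)
open import Relation.Nullary.Decidable using (dec-true; dec-false; does-⇔)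

iverson : ∀ {p} {P : Set p} → Dec P → ℕ
iverson P? = if does P? then 1 else 0

iverson-mono : ∀ {p q} {P : Set p} {Q : Set q} (P? : Dec P) (Q? : Dec Q) →
               (P → Q) → iverson P? ≤ iverson Q?
iverson-mono (yes p) (yes _) _   = ℕₚ.≤-refl
iverson-mono (yes p) (no ¬q) p→q = ⊥-elim (¬q (p→q p))
iverson-mono (no _)  _       _   = z≤n

iverson-⊎ : ∀ {p q r} {P : Set p} {Q : Set q} {R : Set r} (P? : Dec P) (Q? : Dec Q) (R? : Dec R) →
            (P → Q ⊎ R) → iverson P? ≤ iverson Q? + iverson R?
iverson-⊎ (no _)  _       _       _ = z≤n
iverson-⊎ (yes p) (yes _) _       _ = s≤s z≤n
iverson-⊎ (yes p) (no ¬q) (yes _) _ = s≤s z≤n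
iverson-⊎ (yes p) (no ¬q) (no ¬r) f with f p
... | inj₁ q = ⊥-elim (¬q q)
... | inj₂ r = ⊥-elim (¬r r)

iverson-cong : ∀ {p q} {P : Set p} {Q : Set q} (P? : Dec P) (Q? : Dec Q) →
               (P → Q) → (Q → P) → iverson P? ≡ iverson Q?
iverson-cong P? Q? P→Q Q→P = ℕₚ.≤-antisym (iverson-mono P? Q? P→Q) (iverson-mono Q? P? Q→P)

iverson-does : ∀ {p} {P : Set p} (P? : Dec P) → iverson (does P? Bool.≟ true) ≡ iverson P?
iverson-does (yes _) = refl
iverson-does (no _)  = refl

iverson-no : ∀ {p} {P : Set p} (P? : Dec P) → ¬ P → iverson P? ≡ 0
iverson-no (yes p) ¬p = ⊥-elim (¬p p)
iverson-no (no _)  _  = refl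

∑-mono-≤ : ∀ {n} {f g : Fin n → ℕ} → (∀ i → f i ≤ g i) → sum f ≤ sum g
∑-mono-≤ {zero}  f≤g = z≤n
∑-mono-≤ {suc n} f≤g = ℕₚ.+-mono-≤ (f≤g zero) (∑-mono-≤ (λ i → f≤g (suc i)))

∑-const : ∀ n c → ∑[ i < n ] c ≡ n * c
∑-const zero    c = refl
∑-const (suc n) c = cong (c +_) (∑-const n c)

∑∑-distrib-+ : ∀ {m n} (f g : Fin m → Fin n → ℕ) →
               ∑[ i < m ] ∑[ j < n ] (f i j + g i j) ≡
               ∑[ i < m ] ∑[ j < n ] f i j + ∑[ i < m ] ∑[ j < n ] g i j
∑∑-distrib-+ {n = n} f g = trans (sum-cong-≗ λ i → ∑-distrib-+ (f i) (g i))
                                 (∑-distrib-+ (λ i → ∑[ j < n ] f i j) (λ i → ∑[ j < n ] g i j))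

∑-split : ∀ a {b} (f : Fin (a + b) → ℕ) → sum f ≡ ∑[ i < a ] f (i Fin.↑ˡ b) + ∑[ j < b ] f (a Fin.↑ʳ j)
∑-split zero    f = refl
∑-split (suc a) f =
  trans (cong (f zero +_) (∑-split a (λ i → f (suc i)))) (sym (ℕₚ.+-assoc (f zero) _ _))

∑-combine≤ : ∀ {m n} (b : Fin m) (f : Fin (m * n) → ℕ) → ∑[ j < n ] f (Fin.combine b j) ≤ sum f
∑-combine≤ {suc m} {n} zero    f = ℕₚ.≤-trans (ℕₚ.m≤m+n _ _) (ℕₚ.≤-reflexive (sym (∑-split n f)))
∑-combine≤ {suc m} {n} (suc b) f = ℕₚ.≤-trans (∑-combine≤ b (λ x → f (n Fin.↑ʳ x)))
  (ℕₚ.≤-trans (ℕₚ.m≤n+m _ _) (ℕₚ.≤-reflexive (sym (∑-split n f))))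

∑-iverson≡0 : ∀ {n p} {P : Fin n → Set p} (P? : ∀ i → Dec (P i)) →
              (∀ i → ¬ P i) → ∑[ i < n ] iverson (P? i) ≡ 0
∑-iverson≡0 {n} P? none = trans (sum-cong-≗ (λ i → iverson-no (P? i) (none i))) (sum-replicate-zero n)

∑-iverson≤1 : ∀ {n p} {P : Fin n → Set p} (P? : ∀ i → Dec (P i)) →
              (∀ {i j} → P i → P j → i ≡ j) → ∑[ i < n ] iverson (P? i) ≤ 1
∑-iverson≤1 {zero}  P? unique = z≤n
∑-iverson≤1 {suc n} P? unique with P? zero
... | yes p0 = s≤s (ℕₚ.≤-reflexive (∑-iverson≡0 (λ i → P? (suc i)) λ i pi → Finₚ.0≢1+n (unique p0 pi)))
... | no _   = ∑-iverson≤1 (λ i → P? (suc i)) λ pi pj → Finₚ.suc-injective (unique pi pj)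

∑-iverson≤iverson-∃ : ∀ {n p} {P : Fin n → Set p} (P? : ∀ i → Dec (P i)) →
                      (∀ {i j} → P i → P j → i ≡ j) →
                      ∑[ i < n ] iverson (P? i) ≤ iverson (Finₚ.any? P?)
∑-iverson≤iverson-∃ P? unique with Finₚ.any? P?
... | yes _ = ∑-iverson≤1 P? unique
... | no ∄  = ℕₚ.≤-reflexive (∑-iverson≡0 P? λ i pi → ∄ (i , pi))

∑∑-iverson≤1 : ∀ {m n p} {P : Fin m → Fin n → Set p} (P? : ∀ i j → Dec (P i j)) →
               (∀ {i j i′ j′} → P i j → P i′ j′ → i ≡ i′ × j ≡ j′) →
               ∑[ i < m ] ∑[ j < n ] iverson (P? i j) ≤ 1
∑∑-iverson≤1 P? unique = ℕₚ.≤-trans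
  (∑-mono-≤ λ i → ∑-iverson≤iverson-∃ (P? i) λ pj pj′ → proj₂ (unique pj pj′))
  (∑-iverson≤1 (λ i → Finₚ.any? (P? i)) λ (_ , pj) (_ , pj′) → proj₁ (unique pj pj′))

∑-iverson-≢ : ∀ {n} (i : Fin (suc n)) → ∑[ j < suc n ] iverson (¬? (i ≟ j)) ≡ n
∑-iverson-≢ {n}     zero    = trans (∑-const n 1) (ℕₚ.*-identityʳ n)
∑-iverson-≢ {suc n} (suc i) = cong suc (∑-iverson-≢ i)

does-true⇒ : ∀ {p} {P : Set p} (P? : Dec P) → does P? ≡ true → P
does-true⇒ (yes p) _ = p

subsetOf : ∀ {n p} {P : Fin n → Set p} → (∀ v → Dec (P v)) → Subset n
subsetOf P? = Vec.tabulate (λ v → does (P? v))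

module _ {n p} {P : Fin n → Set p} (P? : ∀ v → Dec (P v)) where

  ∈-subsetOf⁺ : ∀ {v} → P v → v ∈ subsetOf P?
  ∈-subsetOf⁺ {v} pv = Vecₚ.lookup⇒[]= v _ (trans (Vecₚ.lookup∘tabulate _ v) (dec-true (P? v) pv))

  ∈-subsetOf⁻ : ∀ {v} → v ∈ subsetOf P? → P v
  ∈-subsetOf⁻ {v} v∈ = does-true⇒ (P? v) (trans (sym (Vecₚ.lookup∘tabulate _ v)) (Vecₚ.[]=⇒lookup v∈))

x∈p-y⇒x≢y : ∀ {n} {p : Subset n} {x y : Fin n} → x ∈ p - y → x ≢ y
x∈p-y⇒x≢y {p = p} {x} x∈p-x refl = go x p x∈p-x
  where
  go : ∀ {n} (x : Fin n) (p : Subset n) → x ∉ p - x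
  go zero    (_ ∷ p) ()
  go (suc x) (_ ∷ p) (there x∈) = go x p x∈

x∈p-y⇒x∈p : ∀ {n} {p : Subset n} {x y : Fin n} → x ∈ p - y → x ∈ p
x∈p-y⇒x∈p {p = p} {y = y} = p─q⊆p p ⁅ y ⁆

module SearchTreeTheory {m} (G : Graph m) (G-simple : IsSimple G) where

  G-sym : ∀ u v → G u v ≡ G v u
  G-sym = proj₁ G-simple

  adjacent⇒≢ : ∀ {u v} → G u v ≡ true → u ≢ v
  adjacent⇒≢ {u} uv refl with trans (sym uv) (proj₂ G-simple u)
  ... | ()

  Child : Set
  Child = Σ (Subset m) (SearchTree G)

  Components : Subset m → Fin m → List Child → Set
  Components S r cs = All (IsComponent G (S - r)) (map proj₁ cs)

  Covers : List Child → Fin m → Set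
  Covers cs v = Any (v ∈_) (map proj₁ cs)

  heights≤ : ∀ {h} (cs : List Child) → All (λ c → height (proj₂ c) ≤ h) cs → heights cs ≤ h
  heights≤ []       []           = z≤n
  heights≤ (_ ∷ cs) (t≤h ∷ cs≤h) = ℕₚ.⊔-lub t≤h (heights≤ cs cs≤h)

  walk-start : ∀ {C u v} → PathIn G C u v → u ∈ C
  walk-start (here u∈C)     = u∈C
  walk-start (step u∈C _ _) = u∈C

  component-closed-under-walks : ∀ {S C D u v} → C ⊆ S → IsComponent G S D →
                                 PathIn G C u v → u ∈ D → v ∈ D
  component-closed-under-walks C⊆S D (here _)       u∈D = u∈D
  component-closed-under-walks C⊆S D (step _ uv w) u∈D =
    component-closed-under-walks C⊆S D w (proj₂ (proj₂ D) _ _ u∈D (C⊆S (walk-start w)) uv)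

  component-⊆ : ∀ {S C D w} → IsComponent G S C → IsComponent G S D → w ∈ C → w ∈ D → C ⊆ D
  component-⊆ {w = w} C D w∈C w∈D {x} x∈C =
    component-closed-under-walks (proj₁ C) D (proj₂ (proj₁ (proj₂ C)) w x w∈C x∈C) w∈D

  component-≡ : ∀ {S C D w} → IsComponent G S C → IsComponent G S D → w ∈ C → w ∈ D → C ≡ D
  component-≡ C D w∈C w∈D = ⊆-antisym (component-⊆ C D w∈C w∈D) (component-⊆ D C w∈D w∈C)

  -- The tube of t rooted at v; junk value S when v ∉ S.
  mutual
    tubeOf : ∀ {S} → SearchTree G S → Fin m → Subset m
    tubeOf (node S r _ cs _) v with v ≟ r
    ... | yes _ = S
    ... | no  _ = childTubeOf S cs v

    childTubeOf : Subset m → List Child → Fin m → Subset m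
    childTubeOf S []             v = S
    childTubeOf S ((C , t) ∷ cs) v with v ∈? C
    ... | yes _ = tubeOf t v
    ... | no  _ = childTubeOf S cs v

  mutual
    tube⊆ : ∀ {S} {t : SearchTree G S} {X} → IsTube t X → X ⊆ S
    tube⊆ (root t) = λ x∈ → x∈
    tube⊆ {t = node S r _ cs (comps , _)} (sub X∈cs) = x∈p-y⇒x∈p ∘′ childTube⊆ cs comps X∈cs

    childTube⊆ : ∀ {S r X} cs → Components S r cs → Any (λ c → IsTube (proj₂ c) X) cs → X ⊆ S - r
    childTube⊆ (_ ∷ _)  (C ∷ _)     (here X∈t)   = proj₁ C ∘′ tube⊆ X∈t
    childTube⊆ (_ ∷ cs) (_ ∷ comps) (there X∈cs) = childTube⊆ cs comps X∈cs

  tubeOf-sole-child : ∀ {S r r∈S C} {t : SearchTree G C} {comps a b} → b ∈ S →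
                      (a ≢ r → a ∈ C × b ∈ tubeOf t a) →
                      b ∈ tubeOf (node S r r∈S ((C , t) ∷ []) comps) a
  tubeOf-sole-child {r = r} {C = C} {a = a} b∈S below with a ≟ r
  ... | yes _  = b∈S
  ... | no a≢r with a ∈? C
  ...   | yes _  = proj₂ (below a≢r)
  ...   | no a∉C = ⊥-elim (a∉C (proj₁ (below a≢r)))

  mutual
    tubeOf⊆ : ∀ {S v} (t : SearchTree G S) → v ∈ S → tubeOf t v ⊆ S
    tubeOf⊆ {v = v} (node S r _ cs (comps , _ , cover)) v∈S with v ≟ r
    ... | yes _  = λ x∈ → x∈
    ... | no v≢r = x∈p-y⇒x∈p ∘′ childTubeOf⊆ cs comps (cover v (x∈p∧x≢y⇒x∈p-y v∈S v≢r))

    childTubeOf⊆ : ∀ {S r v} cs → Components S r cs → Covers cs v → childTubeOf S cs v ⊆ S - r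
    childTubeOf⊆ {v = v} ((C , t) ∷ cs) (C-comp ∷ comps) v∈cs with v ∈? C
    ... | yes v∈C = proj₁ C-comp ∘′ tubeOf⊆ t v∈C
    childTubeOf⊆ _        _           (here v∈C)   | no v∉C = ⊥-elim (v∉C v∈C)
    childTubeOf⊆ (_ ∷ cs) (_ ∷ comps) (there v∈cs) | no _   = childTubeOf⊆ cs comps v∈cs

  mutual
    ∈-tubeOf : ∀ {S v} (t : SearchTree G S) → v ∈ S → v ∈ tubeOf t v
    ∈-tubeOf {v = v} (node S r _ cs (_ , _ , cover)) v∈S with v ≟ r
    ... | yes _  = v∈S
    ... | no v≢r = ∈-childTubeOf cs (cover v (x∈p∧x≢y⇒x∈p-y v∈S v≢r))

    ∈-childTubeOf : ∀ {S v} cs → Covers cs v → v ∈ childTubeOf S cs v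
    ∈-childTubeOf {v = v} ((C , t) ∷ cs) v∈cs with v ∈? C
    ... | yes v∈C = ∈-tubeOf t v∈C
    ∈-childTubeOf _        (here v∈C)   | no v∉C = ⊥-elim (v∉C v∈C)
    ∈-childTubeOf (_ ∷ cs) (there v∈cs) | no _   = ∈-childTubeOf cs v∈cs

  mutual
    tubeOf-isTube : ∀ {S v} (t : SearchTree G S) → v ∈ S → IsTube t (tubeOf t v)
    tubeOf-isTube {v = v} t@(node S r _ cs (_ , _ , cover)) v∈S with v ≟ r
    ... | yes _  = root t
    ... | no v≢r = sub (childTubeOf-isTube cs (cover v (x∈p∧x≢y⇒x∈p-y v∈S v≢r)))

    childTubeOf-isTube : ∀ {S v} cs → Covers cs v →
                         Any (λ c → IsTube (proj₂ c) (childTubeOf S cs v)) cs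
    childTubeOf-isTube {v = v} ((C , t) ∷ cs) v∈cs with v ∈? C
    ... | yes v∈C = here (tubeOf-isTube t v∈C)
    childTubeOf-isTube _        (here v∈C)   | no v∉C = ⊥-elim (v∉C v∈C)
    childTubeOf-isTube (_ ∷ cs) (there v∈cs) | no _   = there (childTubeOf-isTube cs v∈cs)

  ∈-childTubeOf⁺ : ∀ {S w y} cs → Any (λ c → w ∈ proj₁ c) cs →
                   All (λ c → w ∈ proj₁ c → y ∈ tubeOf (proj₂ c) w) cs → y ∈ childTubeOf S cs w
  ∈-childTubeOf⁺ {w = w} ((C , t) ∷ cs) w∈cs (below ∷ belows) with w ∈? C
  ... | yes w∈C = below w∈C
  ∈-childTubeOf⁺ (_ ∷ cs) (here w∈C)   _              | no w∉C = ⊥-elim (w∉C w∈C)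
  ∈-childTubeOf⁺ (_ ∷ cs) (there w∈cs) (_ ∷ belows)   | no _   = ∈-childTubeOf⁺ cs w∈cs belows

  private
    component-clash : ∀ {S C w} Ds → All (IsComponent G S) Ds → All (C ≢_) Ds →
                      IsComponent G S C → w ∈ C → Any (w ∈_) Ds → ⊥
    component-clash (D ∷ _)  (D-comp ∷ _)     (C≢D ∷ _)   C-comp w∈C (here w∈D)   =
      C≢D (component-≡ C-comp D-comp w∈C w∈D)
    component-clash (_ ∷ Ds) (_      ∷ comps) (_   ∷ C≢s) C-comp w∈C (there w∈Ds) =
      component-clash Ds comps C≢s C-comp w∈C w∈Ds

  mutual
    tubeOf-minimal : ∀ {S X v} {t : SearchTree G S} → IsTube t X → v ∈ X → tubeOf t v ⊆ X
    tubeOf-minimal (root t) v∈S = tubeOf⊆ t v∈S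
    tubeOf-minimal {v = v} {node S r _ cs (comps , unique , _)} (sub X∈cs) v∈X with v ≟ r
    ... | yes refl = ⊥-elim (x∈p-y⇒x≢y (childTube⊆ cs comps X∈cs v∈X) refl)
    ... | no _     = childTubeOf-minimal cs comps unique X∈cs v∈X

    childTubeOf-minimal : ∀ {S r X v} cs → Components S r cs → Unique (map proj₁ cs) →
                          Any (λ c → IsTube (proj₂ c) X) cs → v ∈ X → childTubeOf S cs v ⊆ X
    childTubeOf-minimal {v = v} ((C , t) ∷ cs) (C-comp ∷ comps) (C≢s ∷ unique) X∈cs v∈X
      with v ∈? C | X∈cs
    ... | yes _   | here X∈t    = tubeOf-minimal X∈t v∈X
    ... | yes v∈C | there X∈cs′ =
      ⊥-elim (component-clash _ comps C≢s C-comp v∈C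
               (Anyₚ.map⁺ (Any.map (λ X∈t → tube⊆ X∈t v∈X) X∈cs′)))
    ... | no v∉C  | here X∈t    = ⊥-elim (v∉C (tube⊆ X∈t v∈X))
    ... | no _    | there X∈cs′ = childTubeOf-minimal cs comps unique X∈cs′ v∈X

  mutual
    tubeOf-antisym : ∀ {S u v} (t : SearchTree G S) → u ∈ S → v ∈ S →
                     u ∈ tubeOf t v → v ∈ tubeOf t u → u ≡ v
    tubeOf-antisym {u = u} {v} (node S r _ cs (comps , _ , cover)) u∈S v∈S u∈v v∈u
      with u ≟ r | v ≟ r
    ... | yes refl | yes refl = refl
    ... | yes refl | no v≢r   =
      ⊥-elim (x∈p-y⇒x≢y (childTubeOf⊆ cs comps (cover v (x∈p∧x≢y⇒x∈p-y v∈S v≢r)) u∈v) refl)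
    ... | no u≢r   | yes refl =
      ⊥-elim (x∈p-y⇒x≢y (childTubeOf⊆ cs comps (cover u (x∈p∧x≢y⇒x∈p-y u∈S u≢r)) v∈u) refl)
    ... | no u≢r   | no v≢r   =
      childTubeOf-antisym cs (cover u (x∈p∧x≢y⇒x∈p-y u∈S u≢r))
                             (cover v (x∈p∧x≢y⇒x∈p-y v∈S v≢r)) u∈v v∈u

    childTubeOf-antisym : ∀ {S u v} cs → Covers cs u → Covers cs v →
                          u ∈ childTubeOf S cs v → v ∈ childTubeOf S cs u → u ≡ v
    childTubeOf-antisym {u = u} {v} ((C , t) ∷ cs) u∈cs v∈cs u∈v v∈u with u ∈? C | v ∈? C
    ... | yes u∈C | yes v∈C = tubeOf-antisym t u∈C v∈C u∈v v∈u
    ... | yes u∈C | no v∉C  = ⊥-elim (v∉C (tubeOf⊆ t u∈C v∈u))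
    ... | no u∉C  | yes v∈C = ⊥-elim (u∉C (tubeOf⊆ t v∈C u∈v))
    childTubeOf-antisym _ (here u∈C)   _            _ _ | no u∉C | no _   = ⊥-elim (u∉C u∈C)
    childTubeOf-antisym _ (there _)    (here v∈C)   _ _ | no _   | no v∉C = ⊥-elim (v∉C v∈C)
    childTubeOf-antisym (_ ∷ cs) (there u∈cs) (there v∈cs) u∈v v∈u | no _ | no _ =
      childTubeOf-antisym cs u∈cs v∈cs u∈v v∈u

  mutual
    tubeOf-comparable : ∀ {S u v} (t : SearchTree G S) → G u v ≡ true → u ∈ S → v ∈ S →
                        v ∈ tubeOf t u ⊎ u ∈ tubeOf t v
    tubeOf-comparable {u = u} {v} (node S r _ cs (comps , _ , cover)) uv u∈S v∈S
      with u ≟ r | v ≟ r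
    ... | yes _  | _      = inj₁ v∈S
    ... | no _   | yes _  = inj₂ u∈S
    ... | no u≢r | no v≢r =
      childTubeOf-comparable cs comps uv (x∈p∧x≢y⇒x∈p-y u∈S u≢r) (x∈p∧x≢y⇒x∈p-y v∈S v≢r)
        (cover u (x∈p∧x≢y⇒x∈p-y u∈S u≢r)) (cover v (x∈p∧x≢y⇒x∈p-y v∈S v≢r))

    childTubeOf-comparable : ∀ {S r u v} cs → Components S r cs → G u v ≡ true →
                             u ∈ S - r → v ∈ S - r → Covers cs u → Covers cs v →
                             v ∈ childTubeOf S cs u ⊎ u ∈ childTubeOf S cs v
    childTubeOf-comparable {u = u} {v} ((C , t) ∷ cs) (C-comp ∷ comps) uv u∈S v∈S u∈cs v∈cs
      with u ∈? C | v ∈? C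
    ... | yes u∈C | yes v∈C = tubeOf-comparable t uv u∈C v∈C
    ... | yes u∈C | no v∉C  = ⊥-elim (v∉C (proj₂ (proj₂ C-comp) u v u∈C v∈S uv))
    ... | no u∉C  | yes v∈C = ⊥-elim (u∉C (proj₂ (proj₂ C-comp) v u v∈C u∈S (trans (G-sym v u) uv)))
    childTubeOf-comparable _ _ _ _ _ (here u∈C) _ | no u∉C | no _ = ⊥-elim (u∉C u∈C)
    childTubeOf-comparable _ _ _ _ _ (there _) (here v∈C) | no _ | no v∉C = ⊥-elim (v∉C v∈C)
    childTubeOf-comparable (_ ∷ cs) (_ ∷ comps) uv u∈S v∈S (there u∈cs) (there v∈cs) | no _ | no _ =
      childTubeOf-comparable cs comps uv u∈S v∈S u∈cs v∈cs

  -- Cliques force height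

  IsClique : ∀ {c} → (Fin c → Fin m) → Set
  IsClique κ = ∀ {i j} → i ≢ j → G (κ i) (κ j) ≡ true

  mutual
    clique≤height : ∀ {S c} (t : SearchTree G S) (κ : Fin c → Fin m) →
                    IsClique κ → (∀ i → κ i ∈ S) → c ≤ height t
    clique≤height {c = zero}  _ _ _ _ = z≤n
    clique≤height {c = suc c} (node S r _ cs (comps , _ , cover)) κ κ-clique κ∈S
      with Finₚ.any? (λ i → κ i ≟ r)
    ... | yes (i , refl) = s≤s (clique≤heights cs comps cover (κ ∘′ Fin.punchIn i)
      (λ j≢k → κ-clique (j≢k ∘′ Finₚ.punchIn-injective i _ _))
      (λ j → x∈p∧x≢y⇒x∈p-y (κ∈S _) (adjacent⇒≢ (κ-clique (Finₚ.punchInᵢ≢i i j)))))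
    ... | no r∉κ = ℕₚ.m≤n⇒m≤1+n (clique≤heights cs comps cover κ κ-clique
      (λ i → x∈p∧x≢y⇒x∈p-y (κ∈S i) (r∉κ ∘′ (i ,_))))

    -- A clique avoiding the root lies inside the single component containing κ zero.
    clique≤heights : ∀ {S r c} cs → Components S r cs → (∀ v → v ∈ S - r → Covers cs v) →
                     (κ : Fin c → Fin m) → IsClique κ → (∀ i → κ i ∈ S - r) → c ≤ heights cs
    clique≤heights {c = zero}  _  _     _     _ _        _   = z≤n
    clique≤heights {c = suc c} cs comps cover κ κ-clique κ∈S = go cs comps (cover _ (κ∈S zero))
      where
      go : ∀ cs → Components _ _ cs → Covers cs (κ zero) → suc c ≤ heights cs
      go ((C , t) ∷ cs) (C-comp ∷ _) (here κ₀∈C) =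
        ℕₚ.≤-trans (clique≤height t κ κ-clique κ∈C) (ℕₚ.m≤m⊔n (height t) (heights cs))
        where
        κ∈C : ∀ i → κ i ∈ C
        κ∈C zero    = κ₀∈C
        κ∈C (suc i) = proj₂ (proj₂ C-comp) _ _ κ₀∈C (κ∈S (suc i)) (κ-clique λ ())
      go ((_ , t) ∷ cs) (_ ∷ comps) (there κ₀∈cs) =
        ℕₚ.≤-trans (go cs comps κ₀∈cs) (ℕₚ.m≤n⊔m (height t) (heights cs))

  -- Rotations reverse at most one edge

  tubeOf-injective : ∀ {S u v} (t : SearchTree G S) → u ∈ S → v ∈ S → tubeOf t u ≡ tubeOf t v → u ≡ v
  tubeOf-injective t u∈S v∈S tu≡tv = tubeOf-antisym t u∈S v∈S
    (subst (_ ∈_) tu≡tv (∈-tubeOf t u∈S)) (subst (_ ∈_) (sym tu≡tv) (∈-tubeOf t v∈S))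

  sameTree⇒tubeOf≡ : ∀ {T U : SearchTreeOn G} → SameTree T U → ∀ v → tubeOf T v ≡ tubeOf U v
  sameTree⇒tubeOf≡ {T} {U} same v =
    ⊆-antisym (⊆ T U (λ X → proj₂ (same X))) (⊆ U T (λ X → proj₁ (same X)))
    where
    ⊆ : ∀ T U → (∀ X → IsTube U X → IsTube T X) → tubeOf T v ⊆ tubeOf U v
    ⊆ T U U⊆T = tubeOf-minimal (U⊆T _ (tubeOf-isTube U ∈⊤)) (∈-tubeOf U ∈⊤)

  rotation-sym : ∀ {T U : SearchTreeOn G} → Rotation T U → Rotation U T
  rotation-sym (X , Y , X≢Y , X∈ , Y∈ , only) =
    X , Y , X≢Y , ⊎.swap X∈ , ⊎.swap Y∈ , λ Z → only Z ∘′ ⊎.swap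

  -- The symmetric difference {X, Y} already contains W, which is not a tube of T.
  rotation-removes-one : ∀ {T U : SearchTreeOn G} {W Z₁ Z₂} → Rotation T U →
    IsTube U W → ¬ IsTube T W → IsTube T Z₁ → ¬ IsTube U Z₁ → IsTube T Z₂ → ¬ IsTube U Z₂ → Z₁ ≡ Z₂
  rotation-removes-one (X , Y , _ , _ , _ , only) W∈U W∉T Z₁∈T Z₁∉U Z₂∈T Z₂∉U
    with only _ (inj₁ (Z₁∈T , Z₁∉U)) | only _ (inj₁ (Z₂∈T , Z₂∉U)) | only _ (inj₂ (W∈U , W∉T))
  ... | inj₁ refl | inj₁ refl | _         = refl
  ... | inj₂ refl | inj₂ refl | _         = refl
  ... | inj₁ refl | inj₂ refl | inj₁ refl = ⊥-elim (W∉T Z₁∈T)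
  ... | inj₁ refl | inj₂ refl | inj₂ refl = ⊥-elim (W∉T Z₂∈T)
  ... | inj₂ refl | inj₁ refl | inj₁ refl = ⊥-elim (W∉T Z₂∈T)
  ... | inj₂ refl | inj₁ refl | inj₂ refl = ⊥-elim (W∉T Z₁∈T)

  record Flips (T U : SearchTreeOn G) (a b : Fin m) : Set where
    field
      edge     : G a b ≡ true
      below-T  : b ∈ tubeOf T a
      ¬below-U : b ∉ tubeOf U a

  module _ {T U : SearchTreeOn G} {a b} (flip : Flips T U a b) where
    open Flips flip

    flips-reverse : a ∈ tubeOf U b
    flips-reverse with tubeOf-comparable U edge ∈⊤ ∈⊤
    ... | inj₁ b∈a = ⊥-elim (¬below-U b∈a)
    ... | inj₂ a∈b = a∈b

    flips-lost-tube : ¬ IsTube U (tubeOf T b)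
    flips-lost-tube Tb∈U = ¬below-U (subst (_∈ tubeOf U a) a≡b (∈-tubeOf U ∈⊤))
      where
      a≡b : a ≡ b
      a≡b = tubeOf-antisym T ∈⊤ ∈⊤ (tubeOf-minimal Tb∈U (∈-tubeOf T ∈⊤) flips-reverse) below-T

    flips-gained-tube : ¬ IsTube T (tubeOf U a)
    flips-gained-tube Ua∈T = ¬below-U (tubeOf-minimal Ua∈T (∈-tubeOf U ∈⊤) below-T)

  rotation-flips-once : ∀ {T U : SearchTreeOn G} → Rotation T U →
    ∀ {a b a′ b′} → Flips T U a b → Flips T U a′ b′ → a ≡ a′ × b ≡ b′
  rotation-flips-once {T} {U} rot f f′ =
    tubeOf-injective U ∈⊤ ∈⊤ (rotation-removes-one (rotation-sym rot)
      (tubeOf-isTube T ∈⊤) (flips-lost-tube f)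
      (tubeOf-isTube U ∈⊤) (flips-gained-tube f) (tubeOf-isTube U ∈⊤) (flips-gained-tube f′)) ,
    tubeOf-injective T ∈⊤ ∈⊤ (rotation-removes-one rot
      (tubeOf-isTube U ∈⊤) (flips-gained-tube f)
      (tubeOf-isTube T ∈⊤) (flips-lost-tube f) (tubeOf-isTube T ∈⊤) (flips-lost-tube f′))

  Agree : SearchTreeOn G → SearchTreeOn G → Fin m → Fin m → Set
  Agree R T a b = G a b ≡ true × b ∈ tubeOf R a × b ∈ tubeOf T a

  agree? : ∀ R T a b → Dec (Agree R T a b)
  agree? R T a b = (G a b Bool.≟ true) ×-dec (b ∈? tubeOf R a) ×-dec (b ∈? tubeOf T a)

  flips? : ∀ T U a b → Dec (Flips T U a b)
  flips? T U a b = map′ (λ (e , b∈T , b∉U) → record { edge = e ; below-T = b∈T ; ¬below-U = b∉U })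
                        (λ f → Flips.edge f , Flips.below-T f , Flips.¬below-U f)
                        ((G a b Bool.≟ true) ×-dec (b ∈? tubeOf T a) ×-dec ¬? (b ∈? tubeOf U a))

  agreement : SearchTreeOn G → SearchTreeOn G → ℕ
  agreement R T = ∑[ a < m ] ∑[ b < m ] iverson (agree? R T a b)

  degreeSum : ℕ
  degreeSum = ∑[ a < m ] ∑[ b < m ] iverson (G a b Bool.≟ true)

  agreement-rotation : ∀ R {T U} → Rotation T U → agreement R T ≤ agreement R U + 1
  agreement-rotation R {T} {U} rot = begin
    agreement R T
      ≤⟨ ∑-mono-≤ (λ a → ∑-mono-≤ λ b →
           iverson-⊎ (agree? R T a b) (agree? R U a b) (flips? T U a b) (agree-or-flip a b)) ⟩
    ∑[ a < m ] ∑[ b < m ] (iverson (agree? R U a b) + iverson (flips? T U a b))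
      ≡⟨ ∑∑-distrib-+ (λ a b → iverson (agree? R U a b)) (λ a b → iverson (flips? T U a b)) ⟩
    agreement R U + ∑[ a < m ] ∑[ b < m ] iverson (flips? T U a b)
      ≤⟨ ℕₚ.+-monoʳ-≤ (agreement R U) (∑∑-iverson≤1 (flips? T U) (rotation-flips-once rot)) ⟩
    agreement R U + 1 ∎
    where
    open ℕₚ.≤-Reasoning
    agree-or-flip : ∀ a b → Agree R T a b → Agree R U a b ⊎ Flips T U a b
    agree-or-flip a b (e , b∈R , b∈T) with b ∈? tubeOf U a
    ... | yes b∈U = inj₁ (e , b∈R , b∈U)
    ... | no b∉U  = inj₂ record { edge = e ; below-T = b∈T ; ¬below-U = b∉U }

  agreement-path : ∀ R {T U k} → RotPath T U k → agreement R T ≤ agreement R U + k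
  agreement-path R {T} {U} (done same) = ℕₚ.≤-reflexive (begin
    agreement R T     ≡⟨ sum-cong-≗ (λ a → sum-cong-≗ λ b →
                           iverson-cong (agree? R T a b) (agree? R U a b)
                             (map₂ (map₂ (subst (b ∈_) (tubeOf≡ a))))
                             (map₂ (map₂ (subst (b ∈_) (sym (tubeOf≡ a)))))) ⟩
    agreement R U     ≡⟨ ℕₚ.+-identityʳ _ ⟨
    agreement R U + 0 ∎)
    where
    open ≡-Reasoning
    tubeOf≡ = sameTree⇒tubeOf≡ same
  agreement-path R {T} {U} (step {U = V} {k = k} rot path) = begin
    agreement R T           ≤⟨ agreement-rotation R rot ⟩
    agreement R V + 1       ≤⟨ ℕₚ.+-monoˡ-≤ 1 (agreement-path R path) ⟩
    agreement R U + k + 1   ≡⟨ ℕₚ.+-assoc (agreement R U) k 1 ⟩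
    agreement R U + (k + 1) ≡⟨ cong (agreement R U +_) (ℕₚ.+-comm k 1) ⟩
    agreement R U + suc k   ∎
    where open ℕₚ.≤-Reasoning

  degreeSum≤2*agreement : ∀ R → degreeSum ≤ agreement R R + agreement R R
  degreeSum≤2*agreement R = begin
    degreeSum
      ≤⟨ ∑-mono-≤ (λ a → ∑-mono-≤ λ b →
           iverson-⊎ (G a b Bool.≟ true) (agree? R R a b) (agree? R R b a) (oriented a b)) ⟩
    ∑[ a < m ] ∑[ b < m ] (iverson (agree? R R a b) + iverson (agree? R R b a))
      ≡⟨ ∑∑-distrib-+ (λ a b → iverson (agree? R R a b)) (λ a b → iverson (agree? R R b a)) ⟩
    agreement R R + ∑[ a < m ] ∑[ b < m ] iverson (agree? R R b a)
      ≡⟨ cong (agreement R R +_) (∑-comm (λ a b → iverson (agree? R R b a))) ⟩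
    agreement R R + agreement R R ∎
    where
    open ℕₚ.≤-Reasoning
    oriented : ∀ a b → G a b ≡ true → Agree R R a b ⊎ Agree R R b a
    oriented a b ab with tubeOf-comparable R ab ∈⊤ ∈⊤
    ... | inj₁ b∈a = inj₁ (ab , b∈a , b∈a)
    ... | inj₂ a∈b = inj₂ (trans (G-sym b a) ab , a∈b , a∈b)

  record Opposite (T U : SearchTreeOn G) : Set where
    field
      reversed : ∀ a b → G a b ≡ true → b ∈ tubeOf T a → b ∉ tubeOf U a

  agreement-opposite : ∀ {T U} → Opposite T U → agreement T U ≡ 0
  agreement-opposite {T} {U} opposite = trans
    (sum-cong-≗ λ a → ∑-iverson≡0 (agree? T U a) λ b (ab , b∈T , b∈U) →
                        Opposite.reversed opposite a b ab b∈T b∈U)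
    (sum-replicate-zero m)

  degreeSum≤2*rotations : ∀ {T U k} → Opposite T U → RotPath T U k → degreeSum ≤ 2 * k
  degreeSum≤2*rotations {T} {U} {k} opposite path = begin
    degreeSum                     ≤⟨ degreeSum≤2*agreement T ⟩
    agreement T T + agreement T T ≤⟨ ℕₚ.+-mono-≤ agreement≤k agreement≤k ⟩
    k + k                         ≡⟨ cong (k +_) (ℕₚ.+-identityʳ k) ⟨
    2 * k                         ∎
    where
    open ℕₚ.≤-Reasoning
    agreement≤k : agreement T T ≤ k
    agreement≤k =
      subst (λ x → agreement T T ≤ x + k) (agreement-opposite opposite) (agreement-path T path)

  hub⇒connected : ∀ {C h} → h ∈ C → (∀ {v} → v ∈ C → v ≢ h → G v h ≡ true) → Connected G C
  hub⇒connected {C} {h} h∈C hub = (h , h∈C) , λ u v u∈C v∈C → to-hub u∈C (from-hub v∈C)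
    where
    from-hub : ∀ {v} → v ∈ C → PathIn G C h v
    from-hub {v} v∈C with v ≟ h
    ... | yes refl = here h∈C
    ... | no v≢h   = step h∈C (trans (G-sym h v) (hub v∈C v≢h)) (here v∈C)
    to-hub : ∀ {u v} → u ∈ C → PathIn G C h v → PathIn G C u v
    to-hub {u} u∈C h⇝v with u ≟ h
    ... | yes refl = h⇝v
    ... | no u≢h   = step u∈C (hub u∈C u≢h) h⇝v

  no-components : ∀ {S} → (∀ v → v ∉ S) → AreComponents G S []
  no-components empty = [] , [] , λ v v∈S → ⊥-elim (empty v v∈S)

  sole-component : ∀ {S} → Connected G S → AreComponents G S (S ∷ [])
  sole-component connected = ((λ v∈ → v∈) , connected , λ _ _ _ v∈S _ → v∈S) ∷ [] , [] ∷ [] , λ _ → here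

  -- Search trees in which every node has at most one child.  The vertex list vs
  -- is the root-to-leaf order, sorted by _≺_, and its last vertex h is adjacent to all others.
  module Chain {ℓ} (_≺_ : Fin m → Fin m → Set ℓ) (≺-irrefl : ∀ {v} → ¬ v ≺ v) where

    record IsChain (S : Subset m) (vs : List (Fin m)) (h : Fin m) : Set ℓ where
      field
        members⁺ : ∀ {v} → v ∈ S → v ∈ₗ vs
        members⁻ : ∀ {v} → v ∈ₗ vs → v ∈ S
        sorted   : AllPairs _≺_ vs
        hub∈     : h ∈ S
        hub      : ∀ {v} → v ∈ S → v ≢ h → G v h ≡ true
        hub-last : ∀ {v} → v ∈ S → ¬ h ≺ v

    ¬IsChain[] : ∀ {S h} → ¬ IsChain S [] h
    ¬IsChain[] c with IsChain.members⁺ c (IsChain.hub∈ c)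
    ... | ()

    module _ {S v w ws h} (c : IsChain S (v ∷ w ∷ ws) h) where
      open IsChain c

      ∈tail⇒≢head : ∀ {x} → x ∈ₗ w ∷ ws → x ≢ v
      ∈tail⇒≢head x∈ refl with sorted
      ... | v≺ ∷ _ = ≺-irrefl (All.lookup v≺ x∈)

      head≺ : ∀ {x} → x ∈ S → x ≢ v → v ≺ x
      head≺ x∈S x≢v with sorted | members⁺ x∈S
      ... | _  ∷ _ | here x≡v = ⊥-elim (x≢v x≡v)
      ... | v≺ ∷ _ | there x∈ = All.lookup v≺ x∈

      hub≢head : h ≢ v
      hub≢head refl with sorted
      ... | (v≺w ∷ _) ∷ _ = hub-last (members⁻ (there (here refl))) v≺w

      chain-tail : IsChain (S - v) (w ∷ ws) h
      chain-tail = record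
        { members⁺ = λ x∈S-v → tail (x∈p-y⇒x≢y x∈S-v) (members⁺ (x∈p-y⇒x∈p x∈S-v))
        ; members⁻ = λ x∈ → x∈p∧x≢y⇒x∈p-y (members⁻ (there x∈)) (∈tail⇒≢head x∈)
        ; sorted   = AllPairs.tail sorted
        ; hub∈     = x∈p∧x≢y⇒x∈p-y hub∈ hub≢head
        ; hub      = hub ∘′ x∈p-y⇒x∈p
        ; hub-last = hub-last ∘′ x∈p-y⇒x∈p
        }
        where
        tail : ∀ {x} → x ≢ v → x ∈ₗ v ∷ w ∷ ws → x ∈ₗ w ∷ ws
        tail x≢v (here refl) = ⊥-elim (x≢v refl)
        tail _   (there x∈)  = x∈

      head∈ : v ∈ S
      head∈ = members⁻ (here refl)

      tail-component : AreComponents G (S - v) ((S - v) ∷ [])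
      tail-component = sole-component (hub⇒connected (IsChain.hub∈ chain-tail) (IsChain.hub chain-tail))

    chain : ∀ {S vs h} → IsChain S vs h → SearchTree G S
    chain {vs = []} c = ⊥-elim (¬IsChain[] c)
    chain {S} {v ∷ []} c = node S v (IsChain.members⁻ c (here refl)) [] (no-components only-v)
      where
      only-v : ∀ x → x ∉ S - v
      only-v x x∈S-v with IsChain.members⁺ c (x∈p-y⇒x∈p x∈S-v)
      ... | here refl = x∈p-y⇒x≢y x∈S-v refl
    chain {S} {v ∷ w ∷ ws} c =
      node S v (head∈ c) ((S - v , chain (chain-tail c)) ∷ []) (tail-component c)

    chain-height : ∀ {S vs h} (c : IsChain S vs h) → height (chain c) ≡ length vs
    chain-height {vs = []}         c = ⊥-elim (¬IsChain[] c)
    chain-height {vs = v ∷ []}     c = refl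
    chain-height {vs = v ∷ w ∷ ws} c =
      cong suc (trans (ℕₚ.⊔-identityʳ _) (chain-height (chain-tail c)))

    chain-tube : ∀ {S vs h} (c : IsChain S vs h) {a b} → a ∈ S → b ∈ S → ¬ b ≺ a →
                 b ∈ tubeOf (chain c) a
    chain-tube {vs = []} c = ⊥-elim (¬IsChain[] c)
    chain-tube {vs = v ∷ []} c {a} _ b∈S _ with a ≟ v
    ... | yes _ = b∈S
    ... | no _  = b∈S
    chain-tube {S} {v ∷ w ∷ ws} c {a} {b} a∈S b∈S b⊀a =
      tubeOf-sole-child {r∈S = head∈ c} {comps = tail-component c} b∈S λ a≢v →
        let a∈S-v = x∈p∧x≢y⇒x∈p-y a∈S a≢v in
        a∈S-v , chain-tube (chain-tail c) a∈S-v
                  (x∈p∧x≢y⇒x∈p-y b∈S λ { refl → b⊀a (head≺ c a∈S a≢v) }) b⊀a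

clique : ∀ p → TPBuild (suc p)
clique zero    = single
clique (suc p) = cone (clique p)

clique-adjacency : ∀ p (i j : Fin (suc p)) → ⟦ clique p ⟧ i j ≡ not (does (i ≟ j))
clique-adjacency zero    zero    zero    = refl
clique-adjacency (suc p) zero    zero    = refl
clique-adjacency (suc p) zero    (suc j) = refl
clique-adjacency (suc p) (suc i) zero    = refl
clique-adjacency (suc p) (suc i) (suc j) = clique-adjacency p i j

module _ {a b} (A : Graph a) (B : Graph b) where

  unionGraph-ˡˡ : ∀ i i′ → unionGraph A B (i Fin.↑ˡ b) (i′ Fin.↑ˡ b) ≡ A i i′
  unionGraph-ˡˡ i i′ rewrite Finₚ.splitAt-↑ˡ a i b | Finₚ.splitAt-↑ˡ a i′ b = refl

  unionGraph-ˡʳ : ∀ i j → unionGraph A B (i Fin.↑ˡ b) (a Fin.↑ʳ j) ≡ false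
  unionGraph-ˡʳ i j rewrite Finₚ.splitAt-↑ˡ a i b | Finₚ.splitAt-↑ʳ a b j = refl

  unionGraph-ʳˡ : ∀ j i → unionGraph A B (a Fin.↑ʳ j) (i Fin.↑ˡ b) ≡ false
  unionGraph-ʳˡ j i rewrite Finₚ.splitAt-↑ˡ a i b | Finₚ.splitAt-↑ʳ a b j = refl

  unionGraph-ʳʳ : ∀ j j′ → unionGraph A B (a Fin.↑ʳ j) (a Fin.↑ʳ j′) ≡ B j j′
  unionGraph-ʳʳ j j′ rewrite Finₚ.splitAt-↑ʳ a b j | Finₚ.splitAt-↑ʳ a b j′ = refl

-- k′ + 1 disjoint cliques of size q′ + 1; vertex combine b i is the i-th vertex of clique b.
-- The last clique has q′ + 0 as index because 1 * suc q′ reduces to suc (q′ + 0).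
cliques : ∀ k′ q′ → TPBuild (suc k′ * suc q′)
cliques zero    q′ = clique (q′ + 0)
cliques (suc k′) q′ = union (clique q′) (cliques k′ q′)

cliques-adjacency : ∀ k′ q′ (b b′ : Fin (suc k′)) (i j : Fin (suc q′)) →
  ⟦ cliques k′ q′ ⟧ (Fin.combine b i) (Fin.combine b′ j) ≡ does (b ≟ b′) ∧ not (does (i ≟ j))
cliques-adjacency zero q′ zero zero i j =
  trans (clique-adjacency (q′ + 0) (i Fin.↑ˡ 0) (j Fin.↑ˡ 0))
        (cong not (does-⇔ (mk⇔ (Finₚ.↑ˡ-injective 0 i j) (cong (Fin._↑ˡ 0)))
                          ((i Fin.↑ˡ 0) ≟ (j Fin.↑ˡ 0)) (i ≟ j)))
cliques-adjacency (suc k′) q′ zero zero i j =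
  trans (unionGraph-ˡˡ ⟦ clique q′ ⟧ ⟦ cliques k′ q′ ⟧ i j) (clique-adjacency q′ i j)
cliques-adjacency (suc k′) q′ zero (suc b′) i j = unionGraph-ˡʳ ⟦ clique q′ ⟧ ⟦ cliques k′ q′ ⟧ i _
cliques-adjacency (suc k′) q′ (suc b) zero i j = unionGraph-ʳˡ ⟦ clique q′ ⟧ ⟦ cliques k′ q′ ⟧ _ j
cliques-adjacency (suc k′) q′ (suc b) (suc b′) i j =
  trans (unionGraph-ʳʳ ⟦ clique q′ ⟧ ⟦ cliques k′ q′ ⟧ _ _) (cliques-adjacency k′ q′ b b′ i j)

Witness : ℕ → ℕ → Set
Witness n t = Σ (Graph (suc n)) λ G → IsSimple G × Connected G ⊤ × TriviallyPerfect G ×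
  TreeDepth G (t + 1) × DiameterAtLeast G ((t + 1) * n) 2

module ConeOverCliques (k′ q′ : ℕ) where

  k q N : ℕ
  k = suc k′
  q = suc q′
  N = k * q

  block : Fin N → Fin k
  block = Fin.quotient q

  combine : Fin k → Fin q → Fin N
  combine = Fin.combine

  position : Fin N → Fin q
  position = Fin.remainder {k} q

  block-combine : ∀ b j → block (combine b j) ≡ b
  block-combine b j = cong proj₁ (Finₚ.remQuot-combine b j)

  combine-block : ∀ x → combine (block x) (position x) ≡ x
  combine-block = Finₚ.combine-remQuot {k} q

  SameBlock : Fin N → Fin N → Set
  SameBlock x y = block x ≡ block y × x ≢ y

  sameBlock? : ∀ x y → Dec (SameBlock x y)
  sameBlock? x y = block x ≟ block y ×-dec ¬? (x ≟ y)

  blockGraph : Graph N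
  blockGraph x y = does (sameBlock? x y)

  blockGraph-combine : ∀ b b′ i j →
    blockGraph (combine b i) (combine b′ j) ≡ does (b ≟ b′) ∧ not (does (i ≟ j))
  blockGraph-combine b b′ i j = does-⇔ (mk⇔ to from) (sameBlock? _ _) (b ≟ b′ ×-dec ¬? (i ≟ j))
    where
    to : SameBlock (combine b i) (combine b′ j) → b ≡ b′ × i ≢ j
    to (same , distinct) with trans (sym (block-combine b i)) (trans same (block-combine b′ j))
    ... | refl = refl , λ { refl → distinct refl }
    from : b ≡ b′ × i ≢ j → SameBlock (combine b i) (combine b′ j)
    from (refl , i≢j) = trans (block-combine b i) (sym (block-combine b j)) ,
                        i≢j ∘′ Finₚ.combine-injectiveʳ b i b j

  blockGraph≗cliques : ∀ x y → blockGraph x y ≡ ⟦ cliques k′ q′ ⟧ x y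
  blockGraph≗cliques x y =
    subst₂ (λ x y → blockGraph x y ≡ ⟦ cliques k′ q′ ⟧ x y) (combine-block x) (combine-block y)
      (trans (blockGraph-combine (block x) (block y) (position x) (position y))
             (sym (cliques-adjacency k′ q′ (block x) (block y) (position x) (position y))))

  G : Graph (suc N)
  G = coneGraph blockGraph

  G-simple : IsSimple G
  G-simple = symmetric , loopless
    where
    symmetric : ∀ u v → G u v ≡ G v u
    symmetric zero    zero    = refl
    symmetric zero    (suc v) = refl
    symmetric (suc u) zero    = refl
    symmetric (suc u) (suc v) = does-⇔ (mk⇔ swap swap) (sameBlock? u v) (sameBlock? v u)
      where
      swap : ∀ {x y} → SameBlock x y → SameBlock y x
      swap (same , distinct) = sym same , distinct ∘′ sym
    loopless : ∀ v → G v v ≡ false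
    loopless zero    = refl
    loopless (suc x) = dec-false (sameBlock? x x) λ (_ , x≢x) → x≢x refl

  G-triviallyPerfect : TriviallyPerfect G
  G-triviallyPerfect = cone (cliques k′ q′) , ↔-id _ , adjacency
    where
    adjacency : ∀ u v → G u v ≡ ⟦ cone (cliques k′ q′) ⟧ u v
    adjacency zero    zero    = refl
    adjacency zero    (suc v) = refl
    adjacency (suc u) zero    = refl
    adjacency (suc u) (suc v) = blockGraph≗cliques u v

  open SearchTreeTheory G G-simple

  G-connected : Connected G ⊤
  G-connected = hub⇒connected ∈⊤ λ { {zero} _ 0≢0 → ⊥-elim (0≢0 refl) ; {suc _} _ _ → refl }

  combine-monoʳ-≤ : ∀ b {i j : Fin q} → toℕ i ≤ toℕ j → toℕ (combine b i) ≤ toℕ (combine b j)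
  combine-monoʳ-≤ b {i} {j} i≤j = subst₂ _≤_ (sym (Finₚ.toℕ-combine b i)) (sym (Finₚ.toℕ-combine b j))
    (ℕₚ.+-monoʳ-≤ (q * toℕ b) i≤j)

  combine-monoʳ-< : ∀ b {i j : Fin q} → i Fin.< j → combine b i Fin.< combine b j
  combine-monoʳ-< b {i} {j} i<j = subst₂ ℕ._<_ (sym (Finₚ.toℕ-combine b i)) (sym (Finₚ.toℕ-combine b j))
    (ℕₚ.+-monoʳ-< (q * toℕ b) i<j)

  blockVertex : Fin k → Fin q → Fin (suc N)
  blockVertex b j = suc (combine b j)

  blockVertices : Fin k → List (Fin (suc N))
  blockVertices b = List.tabulate (blockVertex b)

  open import Data.List.Membership.DecPropositional (_≟_ {suc N}) using () renaming (_∈?_ to _∈ₗ?_)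

  Block : Fin k → Subset (suc N)
  Block b = subsetOf (_∈ₗ? blockVertices b)

  ∈-Block⁺ : ∀ {x b} → block x ≡ b → suc x ∈ Block b
  ∈-Block⁺ {x} refl = ∈-subsetOf⁺ (_∈ₗ? blockVertices (block x))
    (subst (_∈ₗ blockVertices (block x)) (cong suc (combine-block x))
           (Listₚ.∈-tabulate⁺ {f = blockVertex (block x)} (position x)))

  ∈-Block⁻ : ∀ b {v} → v ∈ Block b → ∃ λ j → v ≡ suc (combine b j)
  ∈-Block⁻ b v∈ = Listₚ.∈-tabulate⁻ (∈-subsetOf⁻ (_∈ₗ? blockVertices b) v∈)

  suc∈Block⇒block : ∀ b {x} → suc x ∈ Block b → block x ≡ b
  suc∈Block⇒block b sx∈ with ∈-Block⁻ b sx∈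
  ... | j , refl = block-combine b j

  hubOf : Fin k → Fin (suc N)
  hubOf b = suc (combine b (Fin.fromℕ q′))

  module Ascending  = Chain (Fin._<_ {suc N} {suc N}) (Finₚ.<-irrefl refl)
  module Descending = Chain (Fin._>_ {suc N} {suc N}) (Finₚ.<-irrefl refl)

  block-isChain : ∀ b → Ascending.IsChain (Block b) (blockVertices b) (hubOf b)
  block-isChain b = record
    { members⁺ = ∈-subsetOf⁻ (_∈ₗ? blockVertices b)
    ; members⁻ = ∈-subsetOf⁺ (_∈ₗ? blockVertices b)
    ; sorted   = AllPairsₚ.tabulate⁺-< λ i<j → s≤s (combine-monoʳ-< b i<j)
    ; hub∈     = ∈-subsetOf⁺ (_∈ₗ? blockVertices b)
                   (Listₚ.∈-tabulate⁺ {f = blockVertex b} (Fin.fromℕ q′))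
    ; hub      = λ v∈ v≢hub → hub-adjacent (∈-Block⁻ b v∈) v≢hub
    ; hub-last = λ v∈ → hub-maximal (∈-Block⁻ b v∈)
    }
    where
    hub-adjacent : ∀ {v} → ∃ (λ j → v ≡ suc (combine b j)) → v ≢ hubOf b → G v (hubOf b) ≡ true
    hub-adjacent (j , refl) v≢hub = dec-true (sameBlock? _ _)
      (trans (block-combine b j) (sym (block-combine b _)) , v≢hub ∘′ cong suc)
    hub-maximal : ∀ {v} → ∃ (λ j → v ≡ suc (combine b j)) → ¬ hubOf b Fin.< v
    hub-maximal (j , refl) = ℕₚ.≤⇒≯ (s≤s (combine-monoʳ-≤ b
      (subst (toℕ j ≤_) (sym (Finₚ.toℕ-fromℕ q′)) (Finₚ.toℕ≤pred[n] j))))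

  blockChain : ∀ b → SearchTree G (Block b)
  blockChain b = Ascending.chain (block-isChain b)

  Block⊆⊤-0 : ∀ b → Block b ⊆ ⊤ - zero
  Block⊆⊤-0 b v∈ = x∈p∧x≢y⇒x∈p-y {y = zero} ∈⊤ λ { refl → case ∈-Block⁻ b v∈ of λ () }

  Block-isComponent : ∀ b → IsComponent G (⊤ - zero) (Block b)
  Block-isComponent b = Block⊆⊤-0 b , hub⇒connected hub∈ hub , closed
    where
    open Ascending.IsChain (block-isChain b)
    closed : ∀ u v → u ∈ Block b → v ∈ ⊤ - zero → G u v ≡ true → v ∈ Block b
    closed zero    _       u∈ _  _  = ⊥-elim (x∈p-y⇒x≢y {p = ⊤} {y = zero} (Block⊆⊤-0 b u∈) refl)
    closed _       zero    _  v∈ _  = ⊥-elim (x∈p-y⇒x≢y {p = ⊤} {y = zero} v∈ refl)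
    closed (suc x) (suc y) u∈ _ uv =
      ∈-Block⁺ (trans (sym (proj₁ (does-true⇒ (sameBlock? x y) uv))) (suc∈Block⇒block b u∈))

  Block-injective : ∀ {b b′} → Block b ≡ Block b′ → b ≡ b′
  Block-injective {b} {b′} eq =
    trans (sym (block-combine b _))
          (suc∈Block⇒block b′ (subst (hubOf b ∈_) eq (Ascending.IsChain.hub∈ (block-isChain b))))

  blockChild : Fin k → Child
  blockChild b = Block b , blockChain b

  blocks : List Child
  blocks = List.tabulate blockChild

  blocks-areComponents : AreComponents G (⊤ - zero) (map proj₁ blocks)
  blocks-areComponents =
    Allₚ.map⁺ (Allₚ.tabulate⁺ {f = blockChild} Block-isComponent) ,
    AllPairsₚ.map⁺ (AllPairsₚ.tabulate⁺ {f = blockChild} (_∘′ Block-injective)) ,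
    cover
    where
    cover : ∀ v → v ∈ ⊤ - zero → Any (v ∈_) (map proj₁ blocks)
    cover zero    v∈ = ⊥-elim (x∈p-y⇒x≢y {p = ⊤} {y = zero} v∈ refl)
    cover (suc x) _  = Anyₚ.map⁺ (Anyₚ.tabulate⁺ {f = blockChild} (block x) (∈-Block⁺ refl))

  T₀ : SearchTreeOn G
  T₀ = node ⊤ zero ∈⊤ blocks blocks-areComponents

  descending-isChain : Descending.IsChain ⊤ (List.tabulate Fin.opposite) zero
  descending-isChain = record
    { members⁺ = λ {v} _ → subst (_∈ₗ List.tabulate Fin.opposite) (Finₚ.opposite-involutive v)
                                 (Listₚ.∈-tabulate⁺ {f = Fin.opposite} (Fin.opposite v))
    ; members⁻ = λ _ → ∈⊤
    ; sorted   = AllPairsₚ.tabulate⁺-< λ {i} {j} i<j →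
        subst₂ ℕ._<_ (sym (Finₚ.opposite-prop j)) (sym (Finₚ.opposite-prop i))
               (ℕₚ.∸-monoʳ-< (s≤s i<j) (Finₚ.toℕ<n j))
    ; hub∈     = ∈⊤
    ; hub      = λ { {zero} _ 0≢0 → ⊥-elim (0≢0 refl) ; {suc _} _ _ → refl }
    ; hub-last = λ _ ()
    }

  U : SearchTreeOn G
  U = Descending.chain descending-isChain

  T₀-below : ∀ {a b} → G a b ≡ true → a Fin.< b → b ∈ tubeOf T₀ a
  T₀-below {zero}           _  _   = ∈⊤
  T₀-below {suc x} {suc y} xy x<y =
    ∈-childTubeOf⁺ blocks (Anyₚ.tabulate⁺ {f = blockChild} (block x) (∈-Block⁺ refl))
      (Allₚ.tabulate⁺ {f = blockChild} λ β x∈ →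
        Ascending.chain-tube (block-isChain β) x∈
          (∈-Block⁺ (trans (sym (proj₁ (does-true⇒ (sameBlock? x y) xy))) (suc∈Block⇒block β x∈)))
          (ℕₚ.<-asym x<y))

  U-below : ∀ {a b} → ¬ a Fin.< b → b ∈ tubeOf U a
  U-below b≯a = Descending.chain-tube descending-isChain ∈⊤ ∈⊤ b≯a

  T₀-U-opposite : Opposite T₀ U
  T₀-U-opposite = record { reversed = reversed }
    where
    reversed : ∀ a b → G a b ≡ true → b ∈ tubeOf T₀ a → b ∉ tubeOf U a
    reversed a b ab b∈T₀a b∈Ua with Finₚ.<-cmp a b
    ... | tri< a<b _ _ = adjacent⇒≢ ab (tubeOf-antisym U ∈⊤ ∈⊤ (U-below (ℕₚ.<-asym a<b)) b∈Ua)
    ... | tri≈ _ a≡b _ = adjacent⇒≢ ab a≡b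
    ... | tri> _ _ b<a = adjacent⇒≢ ab
      (tubeOf-antisym T₀ ∈⊤ ∈⊤ (T₀-below (trans (G-sym b a) ab) b<a) b∈T₀a)

  blockChain-height : ∀ b → height (blockChain b) ≡ q
  blockChain-height b =
    trans (Ascending.chain-height (block-isChain b)) (Listₚ′.length-tabulate (blockVertex b))

  T₀-height : height T₀ ≡ q + 1
  T₀-height = begin
    suc (height (blockChain zero) ⊔ heights rest)
      ≡⟨ cong (λ h → suc (h ⊔ heights rest)) (blockChain-height zero) ⟩
    suc (q ⊔ heights rest)
      ≡⟨ cong suc (ℕₚ.m≥n⇒m⊔n≡m rest≤q) ⟩
    suc q
      ≡⟨ ℕₚ.+-comm 1 q ⟩
    q + 1 ∎
    where
    open ≡-Reasoning
    rest = List.tabulate (λ b → blockChild (suc b))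
    rest≤q : heights rest ≤ q
    rest≤q = heights≤ rest (Allₚ.tabulate⁺ {f = λ b → blockChild (suc b)} λ b →
                              ℕₚ.≤-reflexive (blockChain-height (suc b)))

  coneClique : Fin (suc q) → Fin (suc N)
  coneClique zero    = zero
  coneClique (suc j) = blockVertex zero j

  coneClique-isClique : IsClique coneClique
  coneClique-isClique {zero}  {zero}  0≢0 = ⊥-elim (0≢0 refl)
  coneClique-isClique {zero}  {suc j} _   = refl
  coneClique-isClique {suc i} {zero}  _   = refl
  coneClique-isClique {suc i} {suc j} i≢j =
    trans (blockGraph-combine zero zero i j) (cong not (dec-false (i ≟ j) (i≢j ∘′ cong suc)))

  height≥q+1 : ∀ T → q + 1 ≤ height T
  height≥q+1 T = subst (_≤ height T) (ℕₚ.+-comm 1 q)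
    (clique≤height T coneClique coneClique-isClique λ _ → ∈⊤)

  degree : Fin (suc N) → ℕ
  degree a = ∑[ b < suc N ] iverson (G a b Bool.≟ true)

  degree-cone : degree zero ≡ N
  degree-cone = trans (∑-const N 1) (ℕₚ.*-identityʳ N)

  blockGraph-inBlock : ∀ x j → blockGraph x (combine (block x) j) ≡ not (does (position x ≟ j))
  blockGraph-inBlock x j = begin
    blockGraph x (combine (block x) j)
      ≡⟨ cong (λ z → blockGraph z (combine (block x) j)) (combine-block x) ⟨
    blockGraph (combine (block x) (position x)) (combine (block x) j)
      ≡⟨ blockGraph-combine (block x) (block x) (position x) j ⟩
    does (block x ≟ block x) ∧ not (does (position x ≟ j))
      ≡⟨ cong (_∧ not (does (position x ≟ j))) (dec-true (block x ≟ block x) refl) ⟩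
    not (does (position x ≟ j)) ∎
    where open ≡-Reasoning

  q≤degree : ∀ x → q ≤ degree (suc x)
  q≤degree x = s≤s (begin
    q′
      ≡⟨ ∑-iverson-≢ (position x) ⟨
    ∑[ j < q ] iverson (¬? (position x ≟ j))
      ≡⟨ sum-cong-≗ (λ j → trans (cong (λ b → iverson (b Bool.≟ true)) (blockGraph-inBlock x j))
                                 (iverson-does (¬? (position x ≟ j)))) ⟨
    ∑[ j < q ] iverson (blockGraph x (combine (block x) j) Bool.≟ true)
      ≤⟨ ∑-combine≤ (block x) (λ y → iverson (blockGraph x y Bool.≟ true)) ⟩
    ∑[ y < N ] iverson (blockGraph x y Bool.≟ true) ∎)
    where open ℕₚ.≤-Reasoning

  degreeSum≥ : (q + 1) * N ≤ degreeSum
  degreeSum≥ = begin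
    (q + 1) * N              ≡⟨ ℕₚ.*-comm (q + 1) N ⟩
    N * (q + 1)              ≡⟨ cong (N *_) (ℕₚ.+-comm q 1) ⟩
    N * suc q                ≡⟨ ℕₚ.*-suc N q ⟩
    N + N * q                ≡⟨ cong₂ _+_ degree-cone (∑-const N q) ⟨
    degree zero + ∑[ x < N ] q ≤⟨ ℕₚ.+-monoʳ-≤ (degree zero) (∑-mono-≤ q≤degree) ⟩
    degreeSum                ∎
    where open ℕₚ.≤-Reasoning

  witness : Witness N q
  witness = G , G-simple , G-connected , G-triviallyPerfect , ((T₀ , T₀-height) , height≥q+1) ,
            T₀ , U , λ _ path → ℕₚ.≤-trans degreeSum≥ (degreeSum≤2*rotations T₀-U-opposite path)

theorem14 : ∀ (k n : ℕ) → .{{_ : NonZero k}} → 0 < n → k ∣ n →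
    Σ (Graph (suc n)) λ G →
      IsSimple G × Connected G ⊤ × TriviallyPerfect G ×
      TreeDepth G (n / k + 1) ×
      DiameterAtLeast G ((n / k + 1) * n) 2
theorem14 (suc k′) .(0 * suc k′)      ()  (divides zero refl)
theorem14 (suc k′) .(suc q′ * suc k′) _   (divides (suc q′) refl) =
  subst₂ Witness (ℕₚ.*-comm (suc k′) (suc q′)) (sym (m*n/n≡m (suc q′) (suc k′)))
         (ConeOverCliques.witness k′ q′)
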